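{- Let $p\ge 7$ be a prime. Then $$\binom{2p-1}{p-1}\equiv 1-2p\sum_{k=1}^{p-1}\frac1k-2p^2\sum_{k=1}^{p-1}\frac1{k^2}\equiv 1+2p\sum_{k=1}^{p-1}\frac1k+\frac{2p^3}{3}\sum_{k=1}^{p-1}\frac1{k^3}\pmod{p^6}.$$
   Context: For rational numbers $a,b$ whose denominators are not divisible by the prime $p$, and a positive integer $m$, $a\equiv b\pmod{p^m}$ means that $a-b=p^m c$ for some rational number $c$ whose denominator is not divisible by $p$. -}

module Defs where

open import Data.Nat as ℕ using (ℕ; zero; suc)
open import Data.Nat.Properties using (m^n≢0)
open import Data.Nat.Divisibility using (_∣_)
open import Data.Integer using (+_)
open import Data.Rational using (ℚ; _+_; _-_; _*_; _/_; ↧ₙ_; 0ℚ)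
open import Data.Product using (∃; _×_)
open import Relation.Nullary using (¬_)
open import Relation.Binary.PropositionalEquality using (_≡_)

ℕ→ℚ : ℕ → ℚ
ℕ→ℚ n = (+ n) / 1

pIntegral : ℕ → ℚ → Set
pIntegral p c = ¬ (p ∣ ↧ₙ c)

ModEq : (p m : ℕ) → ℚ → ℚ → Set
ModEq p m a b =
  pIntegral p a × pIntegral p b ×
  ∃ λ c → pIntegral p c × (a - b ≡ ℕ→ℚ (p ℕ.^ m) * c)

harmonic : (r n : ℕ) → ℚ
harmonic r zero = 0ℚ
harmonic r (suc j) = harmonic r j + (+ 1) / (suc j ℕ.^ r)
  where instance _ = m^n≢0 (suc j) r

-- Write S r = ∑_{k<p} 1/k^r and e i for the elementary symmetric functions of 1, 1/2, …, 1/(p−1).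
-- Then C(2p−1, p−1) = ∏_{k<p} (1 + p/k) = ∑_i p^i e i, and Newton's identities express each e i
-- through the S r. Pairing k with p − k gives 1/(p−k) = −1/k − p/k² − p²/k³ − …, whence
-- 2S₁ + pS₂ + p²S₃ + p³S₄ + p⁴S₅ ≡ 0 (mod p⁵), 2S₃ + 3pS₄ + 6p²S₅ ≡ 0 (mod p³) and S₅ ≡ 0 (mod p);
-- comparing the sums over odd and even k gives S₂ ≡ 0 (mod p), hence S₁ ≡ 0 (mod p²). These
-- valuations cut the expansion down to C(2p−1, p−1) ≡ 1 + pS₁ − p²S₂/2 + p³S₃/3 − p⁴S₄/4 (mod p⁶),
-- and both congruences are linear combinations of this one with the two pairing relations.
{-# OPTIONS --safe #-}
module Submission where

open import Agda.Builtin.FromNat using (Number; fromNat)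
open import Data.Unit using (tt)  -- discharges the trivial constraints of overloaded numeric literals
open import Level using (0ℓ)
open import Function using (_∘_; flip)
open import Data.Sum using (_⊎_; inj₁; inj₂; [_,_])
open import Data.Product using (_×_; _,_; proj₁; proj₂; ∃-syntax)
open import Data.Empty using (⊥-elim)
open import Relation.Nullary using (¬_)
open import Relation.Nullary.Decidable using (True; toWitness; dec⇒maybe)
open import Relation.Binary.PropositionalEquality hiding ([_])
open import Data.Nat as ℕ using (ℕ; zero; suc; _≤_; _<_; _∸_; NonZero)
import Data.Nat.Properties as ℕ
import Data.Nat.Literals as ℕ
import Data.Nat.Tactic.RingSolver as ℕ-Solver
open import Data.Nat.Divisibility as ℕ using (_∣_; ∣-trans; ∣⇒≤)
open import Data.Nat.Primality using (Prime; euclidsLemma; prime⇒nonTrivial; composite)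
open import Data.Nat.Combinatorics using (_C_; nC1≡n; nCk+nC[k+1]≡[n+1]C[k+1])
open import Data.Integer as ℤ using (+_)
import Data.Integer.Properties as ℤ
open import Data.Integer.GCD using (gcd)
open import Data.Rational as ℚ using (ℚ; _+_; _-_; _*_; _/_; -_; 0ℚ; 1ℚ; ½; ↥_; ↧_; ↧ₙ_; toℚᵘ; fromℚᵘ)
import Data.Rational.Properties as ℚ
import Data.Rational.Literals as ℚ
open import Data.Rational.Unnormalised as ℚᵘ using (mkℚᵘ)
import Data.Rational.Unnormalised.Properties as ℚᵘ
open import Algebra.Properties.Group ℚ.+-0-group using (x∙y⁻¹≈ε⇒x≈y)
import Tactic.RingSolver.Core.AlmostCommutativeRing as ACR
open import Tactic.RingSolver using (solve-∀)
open import Defs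

instance
  ℕ-number : Number ℕ
  ℕ-number = ℕ.number
  ℚ-number : Number ℚ
  ℚ-number = ℚ.number

-- The zero test lets the solver evaluate rational constants such as ½ and 7/6.
ℚ-ring : ACR.AlmostCommutativeRing 0ℓ 0ℓ
ℚ-ring = ACR.fromCommutativeRing ℚ.+-*-commutativeRing (λ x → dec⇒maybe (0ℚ ℚ.≟ x))

-- The solver recognises only the power operation of its own ring.
module ℚ-Power where
  open ACR.AlmostCommutativeRing ℚ-ring public using (_^_)
  open import Algebra.Properties.Semiring.Exp.TCOptimised (ACR.AlmostCommutativeRing.semiring ℚ-ring) public
    using (^-homo-*)

  ^-suc : ∀ x n → x ^ suc n ≡ x * x ^ n
  ^-suc x = ^-homo-* x 1

open ℚ-Power using (^-suc)

fromℚᵘ-homo-+ : ∀ u v → fromℚᵘ (u ℚᵘ.+ v) ≡ fromℚᵘ u + fromℚᵘ v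
fromℚᵘ-homo-+ u v = ℚ.toℚᵘ-injective (begin
  toℚᵘ (fromℚᵘ (u ℚᵘ.+ v))              ≈⟨ ℚ.toℚᵘ-fromℚᵘ (u ℚᵘ.+ v) ⟩
  u ℚᵘ.+ v                               ≈⟨ ℚᵘ.+-cong (ℚ.toℚᵘ-fromℚᵘ u) (ℚ.toℚᵘ-fromℚᵘ v) ⟨
  toℚᵘ (fromℚᵘ u) ℚᵘ.+ toℚᵘ (fromℚᵘ v)  ≈⟨ ℚ.toℚᵘ-homo-+ (fromℚᵘ u) (fromℚᵘ v) ⟨
  toℚᵘ (fromℚᵘ u + fromℚᵘ v)            ∎)
  where open ℚᵘ.≃-Reasoning

fromℚᵘ-homo-* : ∀ u v → fromℚᵘ (u ℚᵘ.* v) ≡ fromℚᵘ u * fromℚᵘ v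
fromℚᵘ-homo-* u v = ℚ.toℚᵘ-injective (begin
  toℚᵘ (fromℚᵘ (u ℚᵘ.* v))              ≈⟨ ℚ.toℚᵘ-fromℚᵘ (u ℚᵘ.* v) ⟩
  u ℚᵘ.* v                               ≈⟨ ℚᵘ.*-cong (ℚ.toℚᵘ-fromℚᵘ u) (ℚ.toℚᵘ-fromℚᵘ v) ⟨
  toℚᵘ (fromℚᵘ u) ℚᵘ.* toℚᵘ (fromℚᵘ v)  ≈⟨ ℚ.toℚᵘ-homo-* (fromℚᵘ u) (fromℚᵘ v) ⟨
  toℚᵘ (fromℚᵘ u * fromℚᵘ v)            ∎)
  where open ℚᵘ.≃-Reasoning

ℕ→ℚ-+ : ∀ m n → ℕ→ℚ (m ℕ.+ n) ≡ ℕ→ℚ m + ℕ→ℚ n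
ℕ→ℚ-+ m n = trans (cong (_/ 1) numerator) (fromℚᵘ-homo-+ (mkℚᵘ (+ m) 0) (mkℚᵘ (+ n) 0))
  where
  numerator : + (m ℕ.+ n) ≡ + m ℤ.* + 1 ℤ.+ + n ℤ.* + 1
  numerator = trans (ℤ.pos-+ m n) (sym (cong₂ ℤ._+_ (ℤ.*-identityʳ (+ m)) (ℤ.*-identityʳ (+ n))))

ℕ→ℚ-* : ∀ m n → ℕ→ℚ (m ℕ.* n) ≡ ℕ→ℚ m * ℕ→ℚ n
ℕ→ℚ-* m n = trans (cong (_/ 1) (ℤ.pos-* m n)) (fromℚᵘ-homo-* (mkℚᵘ (+ m) 0) (mkℚᵘ (+ n) 0))

ℕ→ℚ-^ : ∀ m n → ℕ→ℚ (m ℕ.^ n) ≡ ℚ-Power._^_ (ℕ→ℚ m) n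
ℕ→ℚ-^ m zero    = refl
ℕ→ℚ-^ m (suc n) = trans (ℕ→ℚ-* m (m ℕ.^ n))
  (trans (cong (ℕ→ℚ m *_) (ℕ→ℚ-^ m n)) (sym (^-suc (ℕ→ℚ m) n)))

↧ₙ-/-∣ : ∀ i d .{{_ : NonZero d}} → ↧ₙ (i / d) ∣ d
↧ₙ-/-∣ i d = ℕ.divides ℤ.∣ gcd i (+ d) ∣ (trans (sym d≡) (ℕ.*-comm (↧ₙ (i / d)) _))
  where
  d≡ : ↧ₙ (i / d) ℕ.* ℤ.∣ gcd i (+ d) ∣ ≡ d
  d≡ = trans (sym (ℤ.abs-* (↧ (i / d)) (gcd i (+ d)))) (cong ℤ.∣_∣ (ℚ.↧-/ i d))

-- the reciprocal 1/n, with the junk value recip 0 = 0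
recip : ℕ → ℚ
recip zero    = 0ℚ
recip (suc n) = + 1 / suc n

recip-/ : ∀ n .{{_ : NonZero n}} → + 1 / n ≡ recip n
recip-/ (suc n) = refl

recip-* : ∀ m n → recip (m ℕ.* n) ≡ recip m * recip n
recip-* zero    n       = sym (ℚ.*-zeroˡ (recip n))
recip-* (suc m) zero    = trans (cong recip (ℕ.*-zeroʳ m)) (sym (ℚ.*-zeroʳ (recip (suc m))))
recip-* (suc m) (suc n) = fromℚᵘ-homo-* (mkℚᵘ (+ 1) m) (mkℚᵘ (+ 1) n)

recip-^ : ∀ m n → recip (m ℕ.^ n) ≡ ℚ-Power._^_ (recip m) n
recip-^ m zero    = refl
recip-^ m (suc n) = trans (recip-* m (m ℕ.^ n))
  (trans (cong (recip m *_) (recip-^ m n)) (sym (^-suc (recip m) n)))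

fraction≡*recip : ∀ m d → + m / suc d ≡ ℕ→ℚ m * recip (suc d)
fraction≡*recip m d = trans (ℚ./-cong (sym (ℤ.*-identityʳ (+ m))) (sym (ℕ.*-identityˡ (suc d))))
  (fromℚᵘ-homo-* (mkℚᵘ (+ m) 0) (mkℚᵘ (+ 1) d))

recip-inverse : ∀ n .{{_ : NonZero n}} → recip n * ℕ→ℚ n ≡ 1
recip-inverse (suc n) = trans (sym (fromℚᵘ-homo-* (mkℚᵘ (+ 1) n) (mkℚᵘ (+ suc n) 0)))
  (ℚ.fromℚᵘ-cong (ℚᵘ.*-inverseˡ (mkℚᵘ (+ suc n) 0)))

recip-+ : ∀ a b .{{_ : NonZero a}} .{{_ : NonZero b}} → recip a + recip b ≡ ℕ→ℚ (a ℕ.+ b) * (recip a * recip b)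
recip-+ a b = begin
  u + w                      ≡⟨ sym (cong₂ _+_ (ℚ.*-identityʳ u) (ℚ.*-identityʳ w)) ⟩
  u * 1 + w * 1              ≡⟨ cong₂ (λ x y → u * x + w * y) (sym (recip-inverse b)) (sym (recip-inverse a)) ⟩
  u * (w * B) + w * (u * A)  ≡⟨ rearrange u w A B ⟩
  (A + B) * (u * w)          ≡⟨ cong (_* (u * w)) (ℕ→ℚ-+ a b) ⟨
  ℕ→ℚ (a ℕ.+ b) * (u * w)    ∎
  where
  open ≡-Reasoning
  u = recip a
  w = recip b
  A = ℕ→ℚ a
  B = ℕ→ℚ b
  rearrange : ∀ u w A B → u * (w * B) + w * (u * A) ≡ (A + B) * (u * w)
  rearrange = solve-∀ ℚ-ring

by-defects : ∀ {x y a b c d} s t → x - y ≡ s * (a - b) + t * (c - d) → a ≡ b → c ≡ d → x ≡ y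
by-defects {x} {y} {b = b} {d = d} s t x-y≡ refl refl = x∙y⁻¹≈ε⇒x≈y x y (trans x-y≡ (vanish s b t d))
  where
  vanish : ∀ s b t d → s * (b - b) + t * (d - d) ≡ 0ℚ
  vanish = solve-∀ ℚ-ring

∑< : ℕ → (ℕ → ℚ) → ℚ
∑< zero    f = 0ℚ
∑< (suc n) f = ∑< n f + f n

syntax ∑< n (λ i → x) = ∑[ i < n ] x

∑-cong : ∀ n {f g : ℕ → ℚ} → (∀ {i} → i < n → f i ≡ g i) → ∑< n f ≡ ∑< n g
∑-cong zero    f≡g = refl
∑-cong (suc n) f≡g = cong₂ _+_ (∑-cong n (f≡g ∘ ℕ.m<n⇒m<1+n)) (f≡g ℕ.≤-refl)

∑-distrib-+ : ∀ n (f g : ℕ → ℚ) → ∑[ i < n ] (f i + g i) ≡ ∑< n f + ∑< n g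
∑-distrib-+ zero    f g = refl
∑-distrib-+ (suc n) f g = trans (cong (_+ (f n + g n)) (∑-distrib-+ n f g)) (shuffle (∑< n f) (∑< n g) (f n) (g n))
  where
  shuffle : ∀ a b c d → (a + b) + (c + d) ≡ (a + c) + (b + d)
  shuffle = solve-∀ ℚ-ring

∑-distrib-- : ∀ n (f g : ℕ → ℚ) → ∑[ i < n ] (f i - g i) ≡ ∑< n f - ∑< n g
∑-distrib-- zero    f g = refl
∑-distrib-- (suc n) f g = trans (cong (_+ (f n - g n)) (∑-distrib-- n f g)) (shuffle (∑< n f) (∑< n g) (f n) (g n))
  where
  shuffle : ∀ a b c d → (a - b) + (c - d) ≡ (a + c) - (b + d)
  shuffle = solve-∀ ℚ-ring

*-distribˡ-∑ : ∀ n c (f : ℕ → ℚ) → ∑[ i < n ] (c * f i) ≡ c * ∑< n f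
*-distribˡ-∑ zero    c f = sym (ℚ.*-zeroʳ c)
*-distribˡ-∑ (suc n) c f = trans (cong (_+ c * f n) (*-distribˡ-∑ n c f)) (sym (ℚ.*-distribˡ-+ c (∑< n f) (f n)))

∑-comm : ∀ m n (f : ℕ → ℕ → ℚ) → ∑[ i < m ] ∑[ j < n ] f i j ≡ ∑[ j < n ] ∑[ i < m ] f i j
∑-comm zero    n f = sym (∑-zero n)
  where
  ∑-zero : ∀ n → ∑[ j < n ] 0ℚ ≡ 0ℚ
  ∑-zero zero    = refl
  ∑-zero (suc n) = cong (_+ 0ℚ) (∑-zero n)
∑-comm (suc m) n f = begin
  ∑[ i < m ] ∑[ j < n ] f i j + ∑[ j < n ] f m j  ≡⟨ cong (_+ ∑[ j < n ] f m j) (∑-comm m n f) ⟩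
  ∑[ j < n ] ∑[ i < m ] f i j + ∑[ j < n ] f m j  ≡⟨ ∑-distrib-+ n (λ j → ∑[ i < m ] f i j) (f m) ⟨
  ∑[ j < n ] (∑[ i < m ] f i j + f m j)           ∎
  where open ≡-Reasoning

∑-split : ∀ m n (f : ℕ → ℚ) → ∑< (m ℕ.+ n) f ≡ ∑< m f + ∑[ i < n ] f (m ℕ.+ i)
∑-split m zero    f = trans (cong (λ k → ∑< k f) (ℕ.+-identityʳ m)) (sym (ℚ.+-identityʳ (∑< m f)))
∑-split m (suc n) f = begin
  ∑< (m ℕ.+ suc n) f                                     ≡⟨ cong (λ k → ∑< k f) (ℕ.+-suc m n) ⟩
  ∑< (m ℕ.+ n) f + f (m ℕ.+ n)                           ≡⟨ cong (_+ f (m ℕ.+ n)) (∑-split m n f) ⟩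
  (∑< m f + ∑[ i < n ] f (m ℕ.+ i)) + f (m ℕ.+ n)       ≡⟨ ℚ.+-assoc (∑< m f) _ _ ⟩
  ∑< m f + (∑[ i < n ] f (m ℕ.+ i) + f (m ℕ.+ n))       ∎
  where open ≡-Reasoning

∑-reverse : ∀ n (f : ℕ → ℚ) → ∑[ i < n ] f (n ∸ suc i) ≡ ∑< n f
∑-reverse zero    f = refl
∑-reverse (suc n) f = begin
  ∑[ i < suc n ] f (n ∸ i)            ≡⟨ ∑-split 1 n (λ i → f (n ∸ i)) ⟩
  (0ℚ + f n) + ∑[ i < n ] f (n ∸ suc i) ≡⟨ cong₂ _+_ (ℚ.+-identityˡ (f n)) (∑-reverse n f) ⟩
  f n + ∑< n f                          ≡⟨ ℚ.+-comm (f n) (∑< n f) ⟩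
  ∑< n f + f n                          ∎
  where open ≡-Reasoning

∑-pairs : ∀ n (f : ℕ → ℚ) → ∑< (n ℕ.+ n) f ≡ ∑[ i < n ] (f (i ℕ.+ i) + f (suc (i ℕ.+ i)))
∑-pairs zero    f = refl
∑-pairs (suc n) f = begin
  ∑< (suc n ℕ.+ suc n) f                                  ≡⟨ cong (λ k → ∑< (suc k) f) (ℕ.+-suc n n) ⟩
  (∑< (n ℕ.+ n) f + f (n ℕ.+ n)) + f (suc (n ℕ.+ n))      ≡⟨ ℚ.+-assoc (∑< (n ℕ.+ n) f) _ _ ⟩
  ∑< (n ℕ.+ n) f + (f (n ℕ.+ n) + f (suc (n ℕ.+ n)))      ≡⟨ cong (_+ (f (n ℕ.+ n) + f (suc (n ℕ.+ n)))) (∑-pairs n f) ⟩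
  ∑[ i < suc n ] (f (i ℕ.+ i) + f (suc (i ℕ.+ i)))        ∎
  where open ≡-Reasoning

even-or-odd : ∀ n → ∃[ m ] (n ≡ m ℕ.+ m ⊎ n ≡ suc (m ℕ.+ m))
even-or-odd zero = 0 , inj₁ refl
even-or-odd (suc n) with even-or-odd n
... | m , inj₁ n≡m+m   = m , inj₂ (cong suc n≡m+m)
... | m , inj₂ n≡1+m+m = suc m , inj₁ (cong suc (trans n≡1+m+m (sym (ℕ.+-suc m m))))

absorption : ∀ n k → suc k ℕ.* (suc n C suc k) ≡ suc n ℕ.* (n C k)
absorption zero    zero    = refl
absorption zero    (suc k) = ℕ.*-zeroʳ (suc (suc k))
absorption (suc n) zero    = trans (ℕ.+-identityʳ _) (trans (nC1≡n (suc (suc n))) (sym (ℕ.*-identityʳ (suc (suc n)))))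
absorption (suc n) (suc k) = begin
  suc (suc k) ℕ.* (suc (suc n) C suc (suc k))
    ≡⟨ cong (suc (suc k) ℕ.*_) (nCk+nC[k+1]≡[n+1]C[k+1] (suc n) (suc k)) ⟨
  suc (suc k) ℕ.* (X ℕ.+ Y)
    ≡⟨ split k X Y ⟩
  X ℕ.+ suc k ℕ.* X ℕ.+ suc (suc k) ℕ.* Y
    ≡⟨ cong₂ (λ a b → X ℕ.+ a ℕ.+ b) (absorption n k) (absorption n (suc k)) ⟩
  X ℕ.+ suc n ℕ.* (n C k) ℕ.+ suc n ℕ.* (n C suc k)
    ≡⟨ merge n X (n C k) (n C suc k) ⟩
  X ℕ.+ suc n ℕ.* (n C k ℕ.+ n C suc k)
    ≡⟨ cong (λ z → X ℕ.+ suc n ℕ.* z) (nCk+nC[k+1]≡[n+1]C[k+1] n k) ⟩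
  X ℕ.+ suc n ℕ.* X
    ∎
  where
  open ≡-Reasoning
  X = suc n C suc k
  Y = suc n C suc (suc k)
  split : ∀ k X Y → suc (suc k) ℕ.* (X ℕ.+ Y) ≡ X ℕ.+ suc k ℕ.* X ℕ.+ suc (suc k) ℕ.* Y
  split = ℕ-Solver.solve-∀
  merge : ∀ n X a b → X ℕ.+ suc n ℕ.* a ℕ.+ suc n ℕ.* b ≡ X ℕ.+ suc n ℕ.* (a ℕ.+ b)
  merge = ℕ-Solver.solve-∀

binomial-step : ∀ m n → ℕ→ℚ ((m ℕ.+ suc n) C suc n) ≡ (1 + ℕ→ℚ m * recip (suc n)) * ℕ→ℚ ((m ℕ.+ n) C n)
binomial-step m n = begin
  B′                      ≡⟨ ℚ.*-identityˡ B′ ⟨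
  1 * B′                  ≡⟨ cong (_* B′) (recip-inverse (suc n)) ⟨
  (t * N) * B′            ≡⟨ ℚ.*-assoc t N B′ ⟩
  t * (N * B′)            ≡⟨ cong (t *_) (ℕ→ℚ-* (suc n) ((m ℕ.+ suc n) C suc n)) ⟨
  t * ℕ→ℚ (suc n ℕ.* ((m ℕ.+ suc n) C suc n))  ≡⟨ cong (λ z → t * ℕ→ℚ z) absorbed ⟩
  t * ℕ→ℚ ((m ℕ.+ suc n) ℕ.* ((m ℕ.+ n) C n))  ≡⟨ cong (t *_) (ℕ→ℚ-* (m ℕ.+ suc n) ((m ℕ.+ n) C n)) ⟩
  t * (ℕ→ℚ (m ℕ.+ suc n) * B)  ≡⟨ cong (λ z → t * (z * B)) (ℕ→ℚ-+ m (suc n)) ⟩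
  t * ((M + N) * B)       ≡⟨ distribute t M N B ⟩
  (M * t + t * N) * B     ≡⟨ cong (λ z → (M * t + z) * B) (recip-inverse (suc n)) ⟩
  (M * t + 1) * B         ≡⟨ cong (_* B) (ℚ.+-comm (M * t) 1) ⟩
  (1 + M * t) * B         ∎
  where
  open ≡-Reasoning
  B′ = ℕ→ℚ ((m ℕ.+ suc n) C suc n)
  B  = ℕ→ℚ ((m ℕ.+ n) C n)
  M  = ℕ→ℚ m
  N  = ℕ→ℚ (suc n)
  t  = recip (suc n)
  absorbed : suc n ℕ.* ((m ℕ.+ suc n) C suc n) ≡ (m ℕ.+ suc n) ℕ.* ((m ℕ.+ n) C n)
  absorbed = trans (cong (λ z → suc n ℕ.* (z C suc n)) (ℕ.+-suc m n))
    (trans (absorption (m ℕ.+ n) n) (cong (ℕ._* ((m ℕ.+ n) C n)) (sym (ℕ.+-suc m n))))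
  distribute : ∀ t M N B → t * ((M + N) * B) ≡ (M * t + t * N) * B
  distribute = solve-∀ ℚ-ring

module SymmetricFunctions where
  open ℚ-Power

  powerSum : ℕ → ℕ → ℚ
  powerSum r n = ∑[ j < n ] (recip (suc j) ^ r)

  elementary : ℕ → ℕ → ℚ
  elementary zero    n       = 1
  elementary (suc i) zero    = 0
  elementary (suc i) (suc n) = elementary (suc i) n + recip (suc n) * elementary i n

  harmonic≡powerSum : ∀ r n → harmonic r n ≡ powerSum r n
  harmonic≡powerSum r zero    = refl
  harmonic≡powerSum r (suc n) = cong₂ _+_ (harmonic≡powerSum r n)
    (trans (recip-/ (suc n ℕ.^ r) {{ℕ.m^n≢0 (suc n) r}}) (recip-^ (suc n) r))

  private
    module At (n : ℕ) where
      t : ℚ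
      t = recip (suc n)
      e s : ℕ → ℚ
      e i = elementary i n
      s r = powerSum r n

  newton₁ : ∀ n → elementary 1 n ≡ powerSum 1 n
  newton₁ zero    = refl
  newton₁ (suc n) = cong₂ _+_ (newton₁ n) (ℚ.*-identityʳ (recip (suc n)))

  -- Passing from n to n + 1 adds t = 1/(n+1) to the variables; the defect of the i-th identity then
  -- grows by t times the defect of the (i−1)-th.
  newton₂ : ∀ n → 2 * elementary 2 n ≡ elementary 1 n * powerSum 1 n - powerSum 2 n
  newton₂ zero    = refl
  newton₂ (suc n) = by-defects 1 t (identity t (e 1) (e 2) (s 1) (s 2)) (newton₂ n) (newton₁ n)
    where
    open At n
    identity : ∀ t e₁ e₂ s₁ s₂ →
      2 * (e₂ + t * e₁) - ((e₁ + t * 1) * (s₁ + t) - (s₂ + t ^ 2))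
        ≡ 1 * (2 * e₂ - (e₁ * s₁ - s₂)) + t * (e₁ - s₁)
    identity = solve-∀ ℚ-ring

  newton₃ : ∀ n → 3 * elementary 3 n ≡ elementary 2 n * powerSum 1 n - elementary 1 n * powerSum 2 n + powerSum 3 n
  newton₃ zero    = refl
  newton₃ (suc n) = by-defects 1 t (identity t (e 1) (e 2) (e 3) (s 1) (s 2) (s 3)) (newton₃ n) (newton₂ n)
    where
    open At n
    identity : ∀ t e₁ e₂ e₃ s₁ s₂ s₃ →
      3 * (e₃ + t * e₂) - ((e₂ + t * e₁) * (s₁ + t) - (e₁ + t * 1) * (s₂ + t ^ 2) + (s₃ + t ^ 3))
        ≡ 1 * (3 * e₃ - (e₂ * s₁ - e₁ * s₂ + s₃)) + t * (2 * e₂ - (e₁ * s₁ - s₂))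
    identity = solve-∀ ℚ-ring

  newton₄ : ∀ n → 4 * elementary 4 n
    ≡ elementary 3 n * powerSum 1 n - elementary 2 n * powerSum 2 n + elementary 1 n * powerSum 3 n - powerSum 4 n
  newton₄ zero    = refl
  newton₄ (suc n) = by-defects 1 t (identity t (e 1) (e 2) (e 3) (e 4) (s 1) (s 2) (s 3) (s 4)) (newton₄ n) (newton₃ n)
    where
    open At n
    identity : ∀ t e₁ e₂ e₃ e₄ s₁ s₂ s₃ s₄ →
      4 * (e₄ + t * e₃)
        - ((e₃ + t * e₂) * (s₁ + t) - (e₂ + t * e₁) * (s₂ + t ^ 2) + (e₁ + t * 1) * (s₃ + t ^ 3) - (s₄ + t ^ 4))
        ≡ 1 * (4 * e₄ - (e₃ * s₁ - e₂ * s₂ + e₁ * s₃ - s₄)) + t * (3 * e₃ - (e₂ * s₁ - e₁ * s₂ + s₃))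
    identity = solve-∀ ℚ-ring

  newton₅ : ∀ n → 5 * elementary 5 n
    ≡ elementary 4 n * powerSum 1 n - elementary 3 n * powerSum 2 n + elementary 2 n * powerSum 3 n
        - elementary 1 n * powerSum 4 n + powerSum 5 n
  newton₅ zero    = refl
  newton₅ (suc n) = by-defects 1 t (identity t (e 1) (e 2) (e 3) (e 4) (e 5) (s 1) (s 2) (s 3) (s 4) (s 5)) (newton₅ n) (newton₄ n)
    where
    open At n
    identity : ∀ t e₁ e₂ e₃ e₄ e₅ s₁ s₂ s₃ s₄ s₅ →
      5 * (e₅ + t * e₄)
        - ((e₄ + t * e₃) * (s₁ + t) - (e₃ + t * e₂) * (s₂ + t ^ 2) + (e₂ + t * e₁) * (s₃ + t ^ 3)
            - (e₁ + t * 1) * (s₄ + t ^ 4) + (s₅ + t ^ 5))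
        ≡ 1 * (5 * e₅ - (e₄ * s₁ - e₃ * s₂ + e₂ * s₃ - e₁ * s₄ + s₅))
            + t * (4 * e₄ - (e₃ * s₁ - e₂ * s₂ + e₁ * s₃ - s₄))
    identity = solve-∀ ℚ-ring

  expansion-step : ∀ (x : ℚ) n N →
    ∑[ i < suc N ] (x ^ i * elementary i (suc n))
      ≡ (1 + x * recip (suc n)) * ∑[ i < suc N ] (x ^ i * elementary i n)
        - x ^ suc N * (recip (suc n) * elementary N n)
  expansion-step x n zero    = base x (recip (suc n))
    where
    base : ∀ x t → 0ℚ + 1 * 1 ≡ (1 + x * t) * (0ℚ + 1 * 1) - x * (t * 1)
    base = solve-∀ ℚ-ring
  expansion-step x n (suc N) = begin
    Σ′ + X * (a + t * b)                             ≡⟨ cong (_+ X * (a + t * b)) (expansion-step x n N) ⟩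
    ((1 + x * t) * Σ - X * (t * b)) + X * (a + t * b) ≡⟨ regroup x t X Σ a b ⟩
    (1 + x * t) * (Σ + X * a) - (x * X) * (t * a)     ≡⟨ cong (λ z → (1 + x * t) * (Σ + X * a) - z * (t * a)) (^-suc x (suc N)) ⟨
    (1 + x * t) * (Σ + X * a) - x ^ suc (suc N) * (t * a) ∎
    where
    open ≡-Reasoning
    t = recip (suc n)
    X = x ^ suc N
    a = elementary (suc N) n
    b = elementary N n
    Σ = ∑[ i < suc N ] (x ^ i * elementary i n)
    Σ′ = ∑[ i < suc N ] (x ^ i * elementary i (suc n))
    regroup : ∀ x t X Σ a b → ((1 + x * t) * Σ - X * (t * b)) + X * (a + t * b) ≡ (1 + x * t) * (Σ + X * a) - (x * X) * (t * a)
    regroup = solve-∀ ℚ-ring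

  expansion-base : ∀ x N → ∑[ i < suc N ] (x ^ i * elementary i 0) ≡ 1
  expansion-base x zero    = refl
  expansion-base x (suc N) = trans (cong₂ _+_ (expansion-base x N) (ℚ.*-zeroʳ (x ^ suc N))) (ℚ.+-identityʳ 1)

open SymmetricFunctions

-- For u = 1/k, w = 1/(p − k) and q = p, the relation u + w = quw says w = −u/(1 − pu).
module ReciprocalPairs {q u w : ℚ} (u+w≡quw : u + w ≡ q * (u * w)) where
  open ℚ-Power

  factor-through : ∀ {x} f → x ≡ (u + w) * f → x ≡ q * (u * w * f)
  factor-through f x≡ = trans x≡ (trans (cong (_* f) u+w≡quw) (ℚ.*-assoc q (u * w) f))

  geometric : ∀ N → w + ∑[ i < N ] (q ^ i * u ^ suc i) ≡ q ^ N * (u ^ N * w)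
  geometric zero    = identity w
    where
    identity : ∀ w → w + 0ℚ ≡ 1 * (1 * w)
    identity = solve-∀ ℚ-ring
  geometric (suc N) = begin
    w + (Σ + Q * u ^ suc N)  ≡⟨ ℚ.+-assoc w Σ _ ⟨
    (w + Σ) + Q * u ^ suc N  ≡⟨ cong₂ (λ a b → a + Q * b) (geometric N) (^-suc u N) ⟩
    Q * (U * w) + Q * (u * U) ≡⟨ factor Q U u w ⟩
    (Q * U) * (u + w)         ≡⟨ cong ((Q * U) *_) u+w≡quw ⟩
    (Q * U) * (q * (u * w))   ≡⟨ regroup Q U q u w ⟩
    (q * Q) * ((u * U) * w)   ≡⟨ cong₂ (λ a b → a * (b * w)) (^-suc q N) (^-suc u N) ⟨
    q ^ suc N * (u ^ suc N * w) ∎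
    where
    open ≡-Reasoning
    Σ = ∑[ i < N ] (q ^ i * u ^ suc i)
    Q = q ^ N
    U = u ^ N
    factor : ∀ Q U u w → Q * (U * w) + Q * (u * U) ≡ (Q * U) * (u + w)
    factor = solve-∀ ℚ-ring
    regroup : ∀ Q U q u w → (Q * U) * (q * (u * w)) ≡ (q * Q) * ((u * U) * w)
    regroup = solve-∀ ℚ-ring

  cube : w ^ 3 + u ^ 3 + 3 * q * u ^ 4 + 6 * q ^ 2 * u ^ 5 ≡ q ^ 3 * (u ^ 3 * w ^ 3 * (10 - 15 * q * u + 6 * q ^ 2 * u ^ 2))
  cube = begin
    w ^ 3 + u ^ 3 + 3 * q * u ^ 4 + 6 * q ^ 2 * u ^ 5       ≡⟨ collect w u q ⟩
    w ^ 3 + u ^ 3 * P                                        ≡⟨ cong (λ z → w ^ 3 + z ^ 3 * P) u≡ ⟩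
    w ^ 3 + (- (w * (1 - q * u))) ^ 3 * P                    ≡⟨ expand w u q ⟩
    q ^ 3 * (u ^ 3 * w ^ 3 * (10 - 15 * q * u + 6 * q ^ 2 * u ^ 2)) ∎
    where
    open ≡-Reasoning
    P = 1 + 3 * q * u + 6 * q ^ 2 * u ^ 2
    u≡ : u ≡ - (w * (1 - q * u))
    u≡ = begin
      u                  ≡⟨ cancel u w ⟩
      (u + w) - w        ≡⟨ cong (_- w) u+w≡quw ⟩
      q * (u * w) - w    ≡⟨ rearrange q u w ⟩
      - (w * (1 - q * u)) ∎
      where
      cancel : ∀ u w → u ≡ (u + w) - w
      cancel = solve-∀ ℚ-ring
      rearrange : ∀ q u w → q * (u * w) - w ≡ - (w * (1 - q * u))
      rearrange = solve-∀ ℚ-ring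
    collect : ∀ w u q → w ^ 3 + u ^ 3 + 3 * q * u ^ 4 + 6 * q ^ 2 * u ^ 5 ≡ w ^ 3 + u ^ 3 * (1 + 3 * q * u + 6 * q ^ 2 * u ^ 2)
    collect = solve-∀ ℚ-ring
    expand : ∀ w u q → w ^ 3 + (- (w * (1 - q * u))) ^ 3 * (1 + 3 * q * u + 6 * q ^ 2 * u ^ 2)
                         ≡ q ^ 3 * (u ^ 3 * w ^ 3 * (10 - 15 * q * u + 6 * q ^ 2 * u ^ 2))
    expand = solve-∀ ℚ-ring

  square : w ^ 2 - u ^ 2 ≡ q * (u * w * (w - u))
  square = factor-through (w - u) (identity u w)
    where
    identity : ∀ u w → w ^ 2 - u ^ 2 ≡ (u + w) * (w - u)
    identity = solve-∀ ℚ-ring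

  fifth : w ^ 5 + u ^ 5 ≡ q * (u * w * (w ^ 4 - w ^ 3 * u + w ^ 2 * u ^ 2 - w * u ^ 3 + u ^ 4))
  fifth = factor-through _ (identity u w)
    where
    identity : ∀ u w → w ^ 5 + u ^ 5 ≡ (u + w) * (w ^ 4 - w ^ 3 * u + w ^ 2 * u ^ 2 - w * u ^ 3 + u ^ 4)
    identity = solve-∀ ℚ-ring

module pAdic (p : ℕ) (p-prime : Prime p) where
  open ℚ-Power

  pℚ : ℚ
  pℚ = ℕ→ℚ p

  p∤ : ∀ {d} .{{_ : NonZero d}} → d < p → ¬ p ∣ d
  p∤ d<p p∣d = ℕ.<⇒≱ d<p (∣⇒≤ p∣d)

  -- a record, so that x can be inferred from a proof of Integral x
  record Integral (x : ℚ) : Set where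
    constructor integral
    field p∤denominator : pIntegral p x

  integral-/ : ∀ i d .{{_ : NonZero d}} → ¬ p ∣ d → Integral (i / d)
  integral-/ i d p∤d = integral (p∤d ∘ flip ∣-trans (↧ₙ-/-∣ i d))

  integral-ℕ : ∀ m → Integral (ℕ→ℚ m)
  integral-ℕ m = integral-/ (+ m) 1 (p∤ (ℕ.nonTrivial⇒n>1 p {{prime⇒nonTrivial p-prime}}))

  integral-+ : ∀ {x y} → Integral x → Integral y → Integral (x + y)
  integral-+ {x@record{}} {y@record{}} (integral p∤↧x) (integral p∤↧y) =
    integral-/ (↥ x ℤ.* ↧ y ℤ.+ ↥ y ℤ.* ↧ x) (↧ₙ x ℕ.* ↧ₙ y)
      ([ p∤↧x , p∤↧y ] ∘ euclidsLemma (↧ₙ x) (↧ₙ y) p-prime)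

  integral-* : ∀ {x y} → Integral x → Integral y → Integral (x * y)
  integral-* {x@record{}} {y@record{}} (integral p∤↧x) (integral p∤↧y) =
    integral-/ (↥ x ℤ.* ↥ y) (↧ₙ x ℕ.* ↧ₙ y)
      ([ p∤↧x , p∤↧y ] ∘ euclidsLemma (↧ₙ x) (↧ₙ y) p-prime)

  integral-neg : ∀ {x} → Integral x → Integral (- x)
  integral-neg {x} (integral p∤↧x) = integral (p∤↧x ∘ subst (p ∣_) (cong ℤ.∣_∣ (ℚ.↧-neg x)))

  integral-- : ∀ {x y} → Integral x → Integral y → Integral (x - y)
  integral-- ix iy = integral-+ ix (integral-neg iy)

  integral-^ : ∀ {x} r → Integral x → Integral (x ^ r)
  integral-^ zero    ix = integral-ℕ 1
  integral-^ (suc r) ix = subst Integral (sym (^-suc _ r)) (integral-* ix (integral-^ r ix))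

  integral-∑ : ∀ n {f} → (∀ {i} → i < n → Integral (f i)) → Integral (∑< n f)
  integral-∑ zero    if = integral-ℕ 0
  integral-∑ (suc n) if = integral-+ (integral-∑ n (if ∘ ℕ.m<n⇒m<1+n)) (if ℕ.≤-refl)

  integral-recip : ∀ {k} → k < p → Integral (recip k)
  integral-recip {zero}  _   = integral-ℕ 0
  integral-recip {suc k} k<p = integral-/ (+ 1) (suc k) (p∤ k<p)

  infix 4 p^_∣_
  record p^_∣_ (m : ℕ) (x : ℚ) : Set where
    constructor divides
    field
      quotient          : ℚ
      integral-quotient : Integral quotient
      equality          : x ≡ pℚ ^ m * quotient

  ∣-zero : ∀ {m} → p^ m ∣ 0ℚ
  ∣-zero {m} = divides 0ℚ (integral-ℕ 0) (sym (ℚ.*-zeroʳ (pℚ ^ m)))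

  ∣-+ : ∀ {m x y} → p^ m ∣ x → p^ m ∣ y → p^ m ∣ (x + y)
  ∣-+ {m} (divides c ic refl) (divides d id refl) = divides (c + d) (integral-+ ic id) (sym (ℚ.*-distribˡ-+ (pℚ ^ m) c d))

  ∣-neg : ∀ {m x} → p^ m ∣ x → p^ m ∣ (- x)
  ∣-neg {m} (divides c ic refl) = divides (- c) (integral-neg ic) (ℚ.neg-distribʳ-* (pℚ ^ m) c)

  ∣-- : ∀ {m x y} → p^ m ∣ x → p^ m ∣ y → p^ m ∣ (x - y)
  ∣-- m∣x m∣y = ∣-+ m∣x (∣-neg m∣y)

  ∣-*ˡ : ∀ {m x} c → Integral c → p^ m ∣ x → p^ m ∣ (c * x)
  ∣-*ˡ {m} c ic (divides d id refl) = divides (c * d) (integral-* ic id) (swap c (pℚ ^ m) d)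
    where
    swap : ∀ c P d → c * (P * d) ≡ P * (c * d)
    swap = solve-∀ ℚ-ring

  ∣-* : ∀ {a b x y} → p^ a ∣ x → p^ b ∣ y → p^ (a ℕ.+ b) ∣ (x * y)
  ∣-* {a} {b} (divides c ic refl) (divides d id refl) = divides (c * d) (integral-* ic id)
    (trans (swap (pℚ ^ a) c (pℚ ^ b) d) (cong (_* (c * d)) (sym (^-homo-* pℚ a b))))
    where
    swap : ∀ A c B d → (A * c) * (B * d) ≡ (A * B) * (c * d)
    swap = solve-∀ ℚ-ring

  ∣-p^ : ∀ m → p^ m ∣ pℚ ^ m
  ∣-p^ m = divides 1 (integral-ℕ 1) (sym (ℚ.*-identityʳ (pℚ ^ m)))

  ∣-weaken : ∀ {m n x} → m ≤ n → p^ n ∣ x → p^ m ∣ x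
  ∣-weaken {m} {n} m≤n (divides c ic refl) =
    divides (pℚ ^ (n ∸ m) * c) (integral-* (integral-^ (n ∸ m) (integral-ℕ p)) ic) (begin
    pℚ ^ n * c                     ≡⟨ cong (λ k → pℚ ^ k * c) (ℕ.m+[n∸m]≡n m≤n) ⟨
    pℚ ^ (m ℕ.+ (n ∸ m)) * c       ≡⟨ cong (_* c) (^-homo-* pℚ m (n ∸ m)) ⟩
    pℚ ^ m * pℚ ^ (n ∸ m) * c      ≡⟨ ℚ.*-assoc (pℚ ^ m) _ c ⟩
    pℚ ^ m * (pℚ ^ (n ∸ m) * c)    ∎)
    where open ≡-Reasoning

  ∣-∑ : ∀ {m} n {f} → (∀ {i} → i < n → p^ m ∣ f i) → p^ m ∣ ∑< n f
  ∣-∑ zero    m∣f = ∣-zero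
  ∣-∑ (suc n) m∣f = ∣-+ (∣-∑ n (m∣f ∘ ℕ.m<n⇒m<1+n)) (m∣f ℕ.≤-refl)

  ∣-≡ : ∀ {m x y} → x ≡ y → p^ m ∣ (x - y)
  ∣-≡ {y = y} refl = subst (p^ _ ∣_) (sym (ℚ.+-inverseʳ y)) ∣-zero

  integral-≈ : ∀ {m x y} → Integral x → p^ m ∣ (x - y) → Integral y
  integral-≈ {m} {x} {y} ix (divides c ic x-y≡) =
    subst Integral (sym (cancel x y)) (integral-- ix (subst Integral (sym x-y≡) (integral-* (integral-^ m (integral-ℕ p)) ic)))
    where
    cancel : ∀ x y → y ≡ x - (x - y)
    cancel = solve-∀ ℚ-ring

  modEq : ∀ {m x y x′ y′} → x′ ≡ x → y′ ≡ y → Integral x → p^ m ∣ (x - y) → ModEq p m x′ y′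
  modEq {m} refl refl ix x≈y@(divides c (integral p∤c) x-y≡) =
    p∤denominator ix , p∤denominator (integral-≈ ix x≈y) , c , p∤c , trans x-y≡ (cong (_* c) (sym (ℕ→ℚ-^ p m)))
    where open Integral

module Wolstenholme (n : ℕ) (p-prime : Prime (suc n)) (7≤p : 7 ≤ suc n) where
  open ℚ-Power
  open pAdic (suc n) p-prime

  ⅓ ¼ ⅕ : ℚ
  ⅓ = + 1 / 3
  ¼ = + 1 / 4
  ⅕ = + 1 / 5

  integral-small : ∀ i d .{{_ : NonZero d}} → {True (d ℕ.<? 7)} → Integral (i / d)
  integral-small i d {d<7} = integral-/ i d (p∤ (ℕ.<-≤-trans (toWitness d<7) 7≤p))

  record Complementary (u w : ℚ) : Set where
    field
      integral-u : Integral u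
      integral-w : Integral w
      u+w≡puw    : u + w ≡ pℚ * (u * w)

  complementary : ∀ a b .{{_ : NonZero a}} .{{_ : NonZero b}} → a ℕ.+ b ≡ suc n → Complementary (recip a) (recip b)
  complementary a b a+b≡p = record
    { integral-u = integral-recip (subst (a <_) a+b≡p (ℕ.m<m+n a (ℕ.>-nonZero⁻¹ b)))
    ; integral-w = integral-recip (subst (b <_) a+b≡p (ℕ.m<n+m b (ℕ.>-nonZero⁻¹ a)))
    ; u+w≡puw    = trans (recip-+ a b) (cong (λ k → ℕ→ℚ k * (recip a * recip b)) a+b≡p)
    }

  module _ {u w} (c : Complementary u w) where
    open Complementary c
    open ReciprocalPairs {pℚ} {u} {w} u+w≡puw

    geometric-∣ : ∀ N → p^ N ∣ (w + ∑[ i < N ] (pℚ ^ i * u ^ suc i))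
    geometric-∣ N = divides (u ^ N * w) (integral-* (integral-^ N integral-u) integral-w) (geometric N)

    cube-∣ : p^ 3 ∣ (w ^ 3 + u ^ 3 + 3 * pℚ * u ^ 4 + 6 * pℚ ^ 2 * u ^ 5)
    cube-∣ = divides _ (integral-* (integral-* (integral-^ 3 integral-u) (integral-^ 3 integral-w))
      (integral-+ (integral-- (integral-ℕ 10) (integral-* (integral-* (integral-ℕ 15) (integral-ℕ (suc n))) integral-u))
                  (integral-* (integral-* (integral-ℕ 6) (integral-^ 2 (integral-ℕ (suc n)))) (integral-^ 2 integral-u))))
      cube

    square-∣ : p^ 1 ∣ (w ^ 2 - u ^ 2)
    square-∣ = divides _ (integral-* (integral-* integral-u integral-w) (integral-- integral-w integral-u)) square

    fifth-∣ : p^ 1 ∣ (w ^ 5 + u ^ 5)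
    fifth-∣ = divides _ (integral-* (integral-* integral-u integral-w)
      (integral-+ (integral-- (integral-+ (integral-- (integral-^ 4 integral-w) (integral-* (integral-^ 3 integral-w) integral-u))
        (integral-* (integral-^ 2 integral-w) (integral-^ 2 integral-u))) (integral-* integral-w (integral-^ 3 integral-u)))
        (integral-^ 4 integral-u)))
      fifth

  S e : ℕ → ℚ
  S r = powerSum r n
  e i = elementary i n

  complement : ∀ {j} → j < n → suc j ℕ.+ suc (n ∸ suc j) ≡ suc n
  complement {j} j<n = trans (ℕ.+-suc (suc j) (n ∸ suc j)) (cong suc (ℕ.m+[n∸m]≡n j<n))

  pair : ∀ {j} → j < n → Complementary (recip (suc j)) (recip (suc (n ∸ suc j)))
  pair j<n = complementary _ _ (complement j<n)

  ∑-complement : ∀ (F : ℚ → ℚ) → ∑[ j < n ] F (recip (suc (n ∸ suc j))) ≡ ∑[ j < n ] F (recip (suc j))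
  ∑-complement F = ∑-reverse n (F ∘ recip ∘ suc)

  geometric-sum-∣ : ∀ N → p^ N ∣ (S 1 + ∑[ i < N ] (pℚ ^ i * S (suc i)))
  geometric-sum-∣ N = subst (p^ N ∣_) sum≡ (∣-∑ n (λ j<n → geometric-∣ (pair j<n) N))
    where
    open ≡-Reasoning
    sum≡ : ∑[ j < n ] (recip (suc (n ∸ suc j)) + ∑[ i < N ] (pℚ ^ i * recip (suc j) ^ suc i))
             ≡ S 1 + ∑[ i < N ] (pℚ ^ i * S (suc i))
    sum≡ = begin
      _ ≡⟨ ∑-distrib-+ n _ _ ⟩
      ∑[ j < n ] recip (suc (n ∸ suc j)) + ∑[ j < n ] ∑[ i < N ] (pℚ ^ i * recip (suc j) ^ suc i)
        ≡⟨ cong₂ _+_ (∑-complement (_^ 1)) (∑-comm n N _) ⟩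
      S 1 + ∑[ i < N ] ∑[ j < n ] (pℚ ^ i * recip (suc j) ^ suc i)
        ≡⟨ cong (_+_ (S 1)) (∑-cong N (λ {i} _ → *-distribˡ-∑ n (pℚ ^ i) _)) ⟩
      S 1 + ∑[ i < N ] (pℚ ^ i * S (suc i)) ∎

  cube-sum-∣ : p^ 3 ∣ (2 * S 3 + 3 * pℚ * S 4 + 6 * pℚ ^ 2 * S 5)
  cube-sum-∣ = subst (p^ 3 ∣_) sum≡ (∣-∑ n (λ j<n → cube-∣ (pair j<n)))
    where
    open ≡-Reasoning
    u w : ℕ → ℚ
    u j = recip (suc j)
    w j = recip (suc (n ∸ suc j))
    double : ∀ x → x + x ≡ 2 * x
    double = solve-∀ ℚ-ring
    sum≡ : ∑[ j < n ] (w j ^ 3 + u j ^ 3 + 3 * pℚ * u j ^ 4 + 6 * pℚ ^ 2 * u j ^ 5)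
             ≡ 2 * S 3 + 3 * pℚ * S 4 + 6 * pℚ ^ 2 * S 5
    sum≡ = begin
      _ ≡⟨ ∑-distrib-+ n _ _ ⟩
      ∑[ j < n ] (w j ^ 3 + u j ^ 3 + 3 * pℚ * u j ^ 4) + ∑[ j < n ] (6 * pℚ ^ 2 * u j ^ 5)
        ≡⟨ cong₂ _+_ (trans (∑-distrib-+ n _ _) (cong₂ _+_ (∑-distrib-+ n _ _) (*-distribˡ-∑ n (3 * pℚ) (λ j → u j ^ 4))))
             (*-distribˡ-∑ n (6 * pℚ ^ 2) (λ j → u j ^ 5)) ⟩
      ∑[ j < n ] (w j ^ 3) + S 3 + 3 * pℚ * S 4 + 6 * pℚ ^ 2 * S 5
        ≡⟨ cong (λ z → z + S 3 + 3 * pℚ * S 4 + 6 * pℚ ^ 2 * S 5) (∑-complement (_^ 3)) ⟩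
      S 3 + S 3 + 3 * pℚ * S 4 + 6 * pℚ ^ 2 * S 5
        ≡⟨ cong (λ z → z + 3 * pℚ * S 4 + 6 * pℚ ^ 2 * S 5) (double (S 3)) ⟩
      2 * S 3 + 3 * pℚ * S 4 + 6 * pℚ ^ 2 * S 5 ∎

  S₅-∣ : p^ 1 ∣ S 5
  S₅-∣ = subst (p^ 1 ∣_) (sym (halve (S 5)))
    (∣-*ˡ ½ (integral-small (+ 1) 2) (subst (p^ 1 ∣_) sum≡ (∣-∑ n (λ j<n → fifth-∣ (pair j<n)))))
    where
    halve : ∀ x → x ≡ ½ * (x + x)
    halve = solve-∀ ℚ-ring
    sum≡ : ∑[ j < n ] (recip (suc (n ∸ suc j)) ^ 5 + recip (suc j) ^ 5) ≡ S 5 + S 5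
    sum≡ = trans (∑-distrib-+ n _ _) (cong (_+ S 5) (∑-complement (_^ 5)))

  n-even : ∃[ m ] n ≡ m ℕ.+ m
  n-even with even-or-odd n
  ... | m , inj₁ n≡m+m   = m , n≡m+m
  ... | m , inj₂ n≡1+m+m = ⊥-elim (Prime.notComposite p-prime (composite 2<p 2∣p))
    where
    2<p : 2 < suc n
    2<p = ℕ.<-≤-trans (ℕ.s≤s (ℕ.s≤s (ℕ.s≤s ℕ.z≤n))) 7≤p
    2∣p : 2 ∣ suc n
    2∣p = ℕ.divides (suc m) (trans (cong suc n≡1+m+m) (double m))
      where
      double : ∀ m → suc (suc (m ℕ.+ m)) ≡ suc m ℕ.* 2
      double = ℕ-Solver.solve-∀

  quarter : ∀ k → recip (2 ℕ.* k) ^ 2 ≡ ¼ * recip k ^ 2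
  quarter k = trans (cong (_^ 2) (recip-* 2 k)) (square-half (recip k))
    where
    square-half : ∀ x → (½ * x) ^ 2 ≡ ¼ * x ^ 2
    square-half = solve-∀ ℚ-ring

  -- With p = 2m + 1 and h = ∑_{k ≤ m} 1/k²: reflecting the upper half gives S₂ ≡ 2h, pairing each odd k
  -- with the even p − k gives S₂ ≡ h/2, and since p ≠ 3 these force S₂ ≡ 0 (mod p).
  module Halves (m : ℕ) (n≡m+m : n ≡ m ℕ.+ m) where
    sq : ℕ → ℚ
    sq j = recip (suc j) ^ 2

    h : ℚ
    h = ∑< m sq

    S₂≡ : S 2 ≡ ∑< (m ℕ.+ m) sq
    S₂≡ = cong (λ k → ∑< k sq) n≡m+m

    upper-half-∣ : p^ 1 ∣ (S 2 - (h + h))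
    upper-half-∣ = subst (p^ 1 ∣_) (sym split) (∣-∑ m λ {i} i<m → square-∣ (complementary _ _ (index i<m)))
      where
      open ≡-Reasoning
      index : ∀ {i} → i < m → suc (m ∸ suc i) ℕ.+ suc (m ℕ.+ i) ≡ suc n
      index {i} i<m = trans (rearrange m i (m ∸ suc i))
        (trans (cong (λ k → suc (m ℕ.+ k)) (ℕ.m+[n∸m]≡n i<m)) (cong suc (sym n≡m+m)))
        where
        rearrange : ∀ m i d → suc d ℕ.+ suc (m ℕ.+ i) ≡ suc (m ℕ.+ (suc i ℕ.+ d))
        rearrange = ℕ-Solver.solve-∀
      cancel : ∀ h a b → (h + a) - (h + b) ≡ a - b
      cancel = solve-∀ ℚ-ring
      split : S 2 - (h + h) ≡ ∑[ i < m ] (sq (m ℕ.+ i) - sq (m ∸ suc i))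
      split = begin
        S 2 - (h + h)
          ≡⟨ cong₂ (λ a b → a - (h + b)) (trans S₂≡ (∑-split m m sq)) (sym (∑-reverse m sq)) ⟩
        (h + ∑[ i < m ] sq (m ℕ.+ i)) - (h + ∑[ i < m ] sq (m ∸ suc i))
          ≡⟨ cancel h (∑[ i < m ] sq (m ℕ.+ i)) (∑[ i < m ] sq (m ∸ suc i)) ⟩
        ∑[ i < m ] sq (m ℕ.+ i) - ∑[ i < m ] sq (m ∸ suc i)
          ≡⟨ ∑-distrib-- m _ _ ⟨
        ∑[ i < m ] (sq (m ℕ.+ i) - sq (m ∸ suc i)) ∎

    parity-pairs-∣ : p^ 1 ∣ (S 2 - (¼ * h + ¼ * h))
    parity-pairs-∣ = subst (p^ 1 ∣_) (sym split) (∣-∑ m λ {i} i<m → subst (p^ 1 ∣_) (sym (term i))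
      (square-∣ (complementary (2 ℕ.* suc (m ∸ suc i)) (suc (i ℕ.+ i)) (index i<m))))
      where
      open ≡-Reasoning
      index : ∀ {i} → i < m → 2 ℕ.* suc (m ∸ suc i) ℕ.+ suc (i ℕ.+ i) ≡ suc n
      index {i} i<m = trans (rearrange i (m ∸ suc i))
        (trans (cong (λ k → suc (k ℕ.+ k)) (ℕ.m+[n∸m]≡n i<m)) (cong suc (sym n≡m+m)))
        where
        rearrange : ∀ i d → 2 ℕ.* suc d ℕ.+ suc (i ℕ.+ i) ≡ suc ((suc i ℕ.+ d) ℕ.+ (suc i ℕ.+ d))
        rearrange = ℕ-Solver.solve-∀
      even : ∀ i → sq (suc (i ℕ.+ i)) ≡ ¼ * sq i
      even i = trans (cong (λ k → recip k ^ 2) (double i)) (quarter (suc i))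
        where
        double : ∀ i → suc (suc (i ℕ.+ i)) ≡ 2 ℕ.* suc i
        double = ℕ-Solver.solve-∀
      cancel : ∀ a b c → (a + b) - (c + b) ≡ a - c
      cancel = solve-∀ ℚ-ring
      term : ∀ i → (sq (i ℕ.+ i) + sq (suc (i ℕ.+ i))) - (¼ * sq (m ∸ suc i) + ¼ * sq i)
                 ≡ recip (suc (i ℕ.+ i)) ^ 2 - recip (2 ℕ.* suc (m ∸ suc i)) ^ 2
      term i = begin
        (sq (i ℕ.+ i) + sq (suc (i ℕ.+ i))) - (¼ * sq (m ∸ suc i) + ¼ * sq i)
          ≡⟨ cong₂ (λ a b → (sq (i ℕ.+ i) + a) - (b + ¼ * sq i)) (even i) (sym (quarter (suc (m ∸ suc i)))) ⟩
        (sq (i ℕ.+ i) + ¼ * sq i) - (recip (2 ℕ.* suc (m ∸ suc i)) ^ 2 + ¼ * sq i)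
          ≡⟨ cancel (sq (i ℕ.+ i)) (¼ * sq i) (recip (2 ℕ.* suc (m ∸ suc i)) ^ 2) ⟩
        sq (i ℕ.+ i) - recip (2 ℕ.* suc (m ∸ suc i)) ^ 2 ∎
      split : S 2 - (¼ * h + ¼ * h) ≡ ∑[ i < m ] ((sq (i ℕ.+ i) + sq (suc (i ℕ.+ i))) - (¼ * sq (m ∸ suc i) + ¼ * sq i))
      split = begin
        S 2 - (¼ * h + ¼ * h)
          ≡⟨ cong₂ (λ a b → a - (¼ * b + ¼ * h)) (trans S₂≡ (∑-pairs m sq)) (sym (∑-reverse m sq)) ⟩
        ∑[ i < m ] (sq (i ℕ.+ i) + sq (suc (i ℕ.+ i))) - (¼ * ∑[ i < m ] sq (m ∸ suc i) + ¼ * h)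
          ≡⟨ cong₂ (λ a b → ∑[ i < m ] (sq (i ℕ.+ i) + sq (suc (i ℕ.+ i))) - (a + b))
               (*-distribˡ-∑ m ¼ (λ i → sq (m ∸ suc i))) (*-distribˡ-∑ m ¼ sq) ⟨
        ∑[ i < m ] (sq (i ℕ.+ i) + sq (suc (i ℕ.+ i))) - (∑[ i < m ] (¼ * sq (m ∸ suc i)) + ∑[ i < m ] (¼ * sq i))
          ≡⟨ cong (λ a → ∑[ i < m ] (sq (i ℕ.+ i) + sq (suc (i ℕ.+ i))) - a) (∑-distrib-+ m _ _) ⟨
        ∑[ i < m ] (sq (i ℕ.+ i) + sq (suc (i ℕ.+ i))) - ∑[ i < m ] (¼ * sq (m ∸ suc i) + ¼ * sq i)
          ≡⟨ ∑-distrib-- m _ _ ⟨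
        ∑[ i < m ] ((sq (i ℕ.+ i) + sq (suc (i ℕ.+ i))) - (¼ * sq (m ∸ suc i) + ¼ * sq i)) ∎

    S₂-∣ : p^ 1 ∣ S 2
    S₂-∣ = subst (p^ 1 ∣_) (sym (eliminate (S 2) h))
      (∣-*ˡ ⅓ (integral-small (+ 1) 3) (∣-- (∣-*ˡ 4 (integral-ℕ 4) parity-pairs-∣) upper-half-∣))
      where
      eliminate : ∀ s h → s ≡ ⅓ * (4 * (s - (¼ * h + ¼ * h)) - (s - (h + h)))
      eliminate = solve-∀ ℚ-ring

  S₂-∣ : p^ 1 ∣ S 2
  S₂-∣ = Halves.S₂-∣ (proj₁ n-even) (proj₂ n-even)

  S₁-∣ : p^ 2 ∣ S 1
  S₁-∣ = subst (p^ 2 ∣_) (sym (isolate pℚ (S 1) (S 2)))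
    (∣-*ˡ ½ (integral-small (+ 1) 2) (∣-- (geometric-sum-∣ 2) (∣-* (∣-p^ 1) S₂-∣)))
    where
    isolate : ∀ P s₁ s₂ → s₁ ≡ ½ * ((s₁ + (0ℚ + 1 * s₁ + P * s₂)) - P * s₂)
    isolate = solve-∀ ℚ-ring

  integral-S : ∀ r → Integral (S r)
  integral-S r = integral-∑ n (λ j<n → integral-^ r (integral-recip (ℕ.s≤s j<n)))

  integral-elementary : ∀ i {m} → m ≤ n → Integral (elementary i m)
  integral-elementary zero    _ = integral-ℕ 1
  integral-elementary (suc i) {zero}  _   = integral-ℕ 0
  integral-elementary (suc i) {suc m} m<n = integral-+ (integral-elementary (suc i) (ℕ.<⇒≤ m<n))
    (integral-* (integral-recip (ℕ.s≤s m<n)) (integral-elementary i (ℕ.<⇒≤ m<n)))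

  binomial-∣ : ∀ N {m} → m ≤ n → p^ suc N ∣ (ℕ→ℚ ((suc n ℕ.+ m) C m) - ∑[ i < suc N ] (pℚ ^ i * elementary i m))
  binomial-∣ N {zero}  _   = ∣-≡ (sym (expansion-base pℚ N))
  binomial-∣ N {suc m} m<n = subst (p^ suc N ∣_) (sym step)
    (∣-+ (∣-*ˡ (1 + pℚ * t) (integral-+ (integral-ℕ 1) (integral-* (integral-ℕ (suc n)) integral-t))
              (binomial-∣ N (ℕ.<⇒≤ m<n)))
         (divides (t * elementary N m) (integral-* integral-t (integral-elementary N (ℕ.<⇒≤ m<n))) refl))
    where
    open ≡-Reasoning
    t = recip (suc m)
    integral-t = integral-recip (ℕ.s≤s m<n)
    A = ℕ→ℚ ((suc n ℕ.+ m) C m)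
    Σ = ∑[ i < suc N ] (pℚ ^ i * elementary i m)
    X = pℚ ^ suc N * (t * elementary N m)
    regroup : ∀ c A Σ X → c * A - (c * Σ - X) ≡ c * (A - Σ) + X
    regroup = solve-∀ ℚ-ring
    step : ℕ→ℚ ((suc n ℕ.+ suc m) C suc m) - ∑[ i < suc N ] (pℚ ^ i * elementary i (suc m)) ≡ (1 + pℚ * t) * (A - Σ) + X
    step = begin
      _                                  ≡⟨ cong₂ _-_ (binomial-step (suc n) m) (expansion-step pℚ m N) ⟩
      (1 + pℚ * t) * A - ((1 + pℚ * t) * Σ - X) ≡⟨ regroup (1 + pℚ * t) A Σ X ⟩
      (1 + pℚ * t) * (A - Σ) + X         ∎

  e₂-∣ : p^ 4 ∣ (e 2 + ½ * S 2)
  e₂-∣ = subst (p^ 4 ∣_) (sym e₂≡) (∣-*ˡ ½ (integral-small (+ 1) 2) (∣-* S₁-∣ S₁-∣))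
    where
    e₂≡ : e 2 + ½ * S 2 ≡ ½ * (S 1 * S 1)
    e₂≡ = by-defects ½ (½ * S 1) (identity (e 1) (e 2) (S 1) (S 2)) (newton₂ n) (newton₁ n)
      where
      identity : ∀ e₁ e₂ s₁ s₂ → (e₂ + ½ * s₂) - ½ * (s₁ * s₁)
        ≡ ½ * (2 * e₂ - (e₁ * s₁ - s₂)) + ½ * s₁ * (e₁ - s₁)
      identity = solve-∀ ℚ-ring

  S₁-∣₁ : p^ 1 ∣ S 1
  S₁-∣₁ = ∣-weaken (ℕ.s≤s ℕ.z≤n) S₁-∣

  e₂-∣₁ : p^ 1 ∣ e 2
  e₂-∣₁ = subst (p^ 1 ∣_) (sym (cancel (e 2) (½ * S 2)))
    (∣-- (∣-weaken (ℕ.s≤s ℕ.z≤n) e₂-∣) (∣-*ˡ ½ (integral-small (+ 1) 2) S₂-∣))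
    where
    cancel : ∀ x y → x ≡ (x + y) - y
    cancel = solve-∀ ℚ-ring

  e₃-∣ : p^ 3 ∣ (e 3 - ⅓ * S 3)
  e₃-∣ = subst (p^ 3 ∣_) (sym e₃≡)
    (∣-*ˡ ⅓ (integral-small (+ 1) 3) (∣-- (∣-* e₂-∣₁ S₁-∣) (∣-* S₁-∣ S₂-∣)))
    where
    e₃≡ : e 3 - ⅓ * S 3 ≡ ⅓ * (e 2 * S 1 - S 1 * S 2)
    e₃≡ = by-defects ⅓ (- (⅓ * S 2)) (identity (e 1) (e 2) (e 3) (S 1) (S 2) (S 3)) (newton₃ n) (newton₁ n)
      where
      identity : ∀ e₁ e₂ e₃ s₁ s₂ s₃ → (e₃ - ⅓ * s₃) - ⅓ * (e₂ * s₁ - s₁ * s₂)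
        ≡ ⅓ * (3 * e₃ - (e₂ * s₁ - e₁ * s₂ + s₃)) + - (⅓ * s₂) * (e₁ - s₁)
      identity = solve-∀ ℚ-ring

  e₄-∣ : p^ 2 ∣ (e 4 + ¼ * S 4)
  e₄-∣ = subst (p^ 2 ∣_) (sym e₄≡) (∣-*ˡ ¼ (integral-small (+ 1) 4)
    (∣-+ (∣-- (∣-*ˡ (e 3) (integral-elementary 3 ℕ.≤-refl) S₁-∣) (∣-* e₂-∣₁ S₂-∣))
         (∣-*ˡ (S 3) (integral-S 3) S₁-∣)))
    where
    e₄≡ : e 4 + ¼ * S 4 ≡ ¼ * (e 3 * S 1 - e 2 * S 2 + S 3 * S 1)
    e₄≡ = by-defects ¼ (¼ * S 3) (identity (e 1) (e 2) (e 3) (e 4) (S 1) (S 2) (S 3) (S 4)) (newton₄ n) (newton₁ n)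
      where
      identity : ∀ e₁ e₂ e₃ e₄ s₁ s₂ s₃ s₄ → (e₄ + ¼ * s₄) - ¼ * (e₃ * s₁ - e₂ * s₂ + s₃ * s₁)
        ≡ ¼ * (4 * e₄ - (e₃ * s₁ - e₂ * s₂ + e₁ * s₃ - s₄)) + ¼ * s₃ * (e₁ - s₁)
      identity = solve-∀ ℚ-ring

  e₅-∣ : p^ 1 ∣ e 5
  e₅-∣ = subst (p^ 1 ∣_) (sym e₅≡) (∣-*ˡ ⅕ (integral-small (+ 1) 5)
    (∣-+ (∣-- (∣-+ (∣-- (∣-*ˡ (e 4) (integral-elementary 4 ℕ.≤-refl) S₁-∣₁)
                        (∣-*ˡ (e 3) (integral-elementary 3 ℕ.≤-refl) S₂-∣))
                   (∣-*ˡ (S 3) (integral-S 3) e₂-∣₁))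
              (∣-*ˡ (S 4) (integral-S 4) S₁-∣₁))
         S₅-∣))
    where
    e₅≡ : e 5 ≡ ⅕ * (e 4 * S 1 - e 3 * S 2 + S 3 * e 2 - S 4 * S 1 + S 5)
    e₅≡ = by-defects ⅕ (- (⅕ * S 4)) (identity (e 1) (e 2) (e 3) (e 4) (e 5) (S 1) (S 2) (S 3) (S 4) (S 5))
      (newton₅ n) (newton₁ n)
      where
      identity : ∀ e₁ e₂ e₃ e₄ e₅ s₁ s₂ s₃ s₄ s₅ → e₅ - ⅕ * (e₄ * s₁ - e₃ * s₂ + s₃ * e₂ - s₄ * s₁ + s₅)
        ≡ ⅕ * (5 * e₅ - (e₄ * s₁ - e₃ * s₂ + e₂ * s₃ - e₁ * s₄ + s₅)) + - (⅕ * s₄) * (e₁ - s₁)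
      identity = solve-∀ ℚ-ring

  binomial : ℚ
  binomial = ℕ→ℚ ((suc n ℕ.+ n) C n)

  integral-binomial : Integral binomial
  integral-binomial = integral-ℕ ((suc n ℕ.+ n) C n)

  binomial≈log : p^ 6 ∣ (binomial - (1 + pℚ * S 1 - ½ * pℚ ^ 2 * S 2 + ⅓ * pℚ ^ 3 * S 3 - ¼ * pℚ ^ 4 * S 4))
  binomial≈log = subst (p^ 6 ∣_) (sym (regroup pℚ binomial (e 1) (e 2) (e 3) (e 4) (e 5) (S 1) (S 2) (S 3) (S 4)))
    (∣-+ (∣-+ (∣-+ (∣-+ (∣-+ (binomial-∣ 5 ℕ.≤-refl) (∣-*ˡ pℚ (integral-ℕ (suc n)) (∣-≡ (newton₁ n))))
      (∣-* (∣-p^ 2) e₂-∣)) (∣-* (∣-p^ 3) e₃-∣)) (∣-* (∣-p^ 4) e₄-∣)) (∣-* (∣-p^ 5) e₅-∣))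
    where
    regroup : ∀ P A e₁ e₂ e₃ e₄ e₅ s₁ s₂ s₃ s₄ →
      A - (1 + P * s₁ - ½ * P ^ 2 * s₂ + ⅓ * P ^ 3 * s₃ - ¼ * P ^ 4 * s₄)
        ≡ (A - (0ℚ + 1 * 1 + P * e₁ + P ^ 2 * e₂ + P ^ 3 * e₃ + P ^ 4 * e₄ + P ^ 5 * e₅))
          + P * (e₁ - s₁) + P ^ 2 * (e₂ + ½ * s₂) + P ^ 3 * (e₃ - ⅓ * s₃) + P ^ 4 * (e₄ + ¼ * s₄) + P ^ 5 * e₅
    regroup = solve-∀ ℚ-ring

  S₁-relation : p^ 6 ∣ (2 * pℚ * S 1 + pℚ ^ 2 * S 2 + pℚ ^ 3 * S 3 + pℚ ^ 4 * S 4)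
  S₁-relation = subst (p^ 6 ∣_) (sym (regroup pℚ (S 1) (S 2) (S 3) (S 4) (S 5)))
    (∣-- (∣-* (∣-p^ 1) (geometric-sum-∣ 5)) (∣-* (∣-p^ 5) S₅-∣))
    where
    regroup : ∀ P s₁ s₂ s₃ s₄ s₅ → 2 * P * s₁ + P ^ 2 * s₂ + P ^ 3 * s₃ + P ^ 4 * s₄
      ≡ P * (s₁ + (0ℚ + 1 * s₁ + P * s₂ + P ^ 2 * s₃ + P ^ 3 * s₄ + P ^ 4 * s₅)) - P ^ 5 * s₅
    regroup = solve-∀ ℚ-ring

  S₃-relation : p^ 6 ∣ (pℚ ^ 3 * S 3 + + 3 / 2 * pℚ ^ 4 * S 4)
  S₃-relation = subst (p^ 6 ∣_) (sym (regroup pℚ (S 3) (S 4) (S 5)))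
    (∣-- (∣-* (∣-*ˡ ½ (integral-small (+ 1) 2) (∣-p^ 3)) cube-sum-∣) (∣-*ˡ 3 (integral-ℕ 3) (∣-* (∣-p^ 5) S₅-∣)))
    where
    regroup : ∀ P s₃ s₄ s₅ → P ^ 3 * s₃ + + 3 / 2 * P ^ 4 * s₄
      ≡ ½ * P ^ 3 * (2 * s₃ + 3 * P * s₄ + 6 * P ^ 2 * s₅) - 3 * (P ^ 5 * s₅)
    regroup = solve-∀ ℚ-ring

  T₁ T₂ : ℚ
  T₁ = 1 - 2 * pℚ * S 1 - 2 * pℚ ^ 2 * S 2
  T₂ = 1 + 2 * pℚ * S 1 + 2 * pℚ ^ 3 * ⅓ * S 3

  binomial≈T₁ : p^ 6 ∣ (binomial - T₁)
  binomial≈T₁ = subst (p^ 6 ∣_) (sym (regroup pℚ binomial (S 1) (S 2) (S 3) (S 4)))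
    (∣-+ (∣-+ binomial≈log (∣-*ˡ (+ 3 / 2) (integral-small (+ 3) 2) S₁-relation))
         (∣-*ˡ (- (+ 7 / 6)) (integral-neg (integral-small (+ 7) 6)) S₃-relation))
    where
    regroup : ∀ P A s₁ s₂ s₃ s₄ → A - (1 - 2 * P * s₁ - 2 * P ^ 2 * s₂)
      ≡ (A - (1 + P * s₁ - ½ * P ^ 2 * s₂ + ⅓ * P ^ 3 * s₃ - ¼ * P ^ 4 * s₄))
        + + 3 / 2 * (2 * P * s₁ + P ^ 2 * s₂ + P ^ 3 * s₃ + P ^ 4 * s₄)
        + - (+ 7 / 6) * (P ^ 3 * s₃ + + 3 / 2 * P ^ 4 * s₄)
    regroup = solve-∀ ℚ-ring

  T₁≈T₂ : p^ 6 ∣ (T₁ - T₂)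
  T₁≈T₂ = subst (p^ 6 ∣_) (sym (regroup pℚ (S 1) (S 2) (S 3) (S 4)))
    (∣-- (∣-*ˡ (+ 4 / 3) (integral-small (+ 4) 3) S₃-relation) (∣-*ˡ 2 (integral-ℕ 2) S₁-relation))
    where
    regroup : ∀ P s₁ s₂ s₃ s₄ → (1 - 2 * P * s₁ - 2 * P ^ 2 * s₂) - (1 + 2 * P * s₁ + 2 * P ^ 3 * ⅓ * s₃)
      ≡ + 4 / 3 * (P ^ 3 * s₃ + + 3 / 2 * P ^ 4 * s₄) - 2 * (2 * P * s₁ + P ^ 2 * s₂ + P ^ 3 * s₃ + P ^ 4 * s₄)
    regroup = solve-∀ ℚ-ring

  binomial≡ : ℕ→ℚ ((2 ℕ.* suc n ∸ 1) C (suc n ∸ 1)) ≡ binomial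
  binomial≡ = cong (λ k → ℕ→ℚ (k C n)) (trans (ℕ.+-suc n (n ℕ.+ 0)) (cong (suc ∘ (n ℕ.+_)) (ℕ.+-identityʳ n)))

  2p≡ : ∀ r → ℕ→ℚ (2 ℕ.* suc n ℕ.^ r) ≡ 2 * pℚ ^ r
  2p≡ r = trans (ℕ→ℚ-* 2 (suc n ℕ.^ r)) (cong (2 *_) (ℕ→ℚ-^ (suc n) r))

  T₁≡ : 1ℚ - ℕ→ℚ (2 ℕ.* suc n) * harmonic 1 n - ℕ→ℚ (2 ℕ.* suc n ℕ.^ 2) * harmonic 2 n ≡ T₁
  T₁≡ = cong₂ (λ a b → 1 - a - b) (cong₂ _*_ (ℕ→ℚ-* 2 (suc n)) (harmonic≡powerSum 1 n))
    (cong₂ _*_ (2p≡ 2) (harmonic≡powerSum 2 n))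

  T₂≡ : 1ℚ + ℕ→ℚ (2 ℕ.* suc n) * harmonic 1 n + (+ (2 ℕ.* suc n ℕ.^ 3) / 3) * harmonic 3 n ≡ T₂
  T₂≡ = cong₂ (λ a b → 1 + a + b) (cong₂ _*_ (ℕ→ℚ-* 2 (suc n)) (harmonic≡powerSum 1 n))
    (cong₂ _*_ (trans (fraction≡*recip (2 ℕ.* suc n ℕ.^ 3) 2) (cong (_* ⅓) (2p≡ 3))) (harmonic≡powerSum 3 n))

open import Data.Nat using (_^_)

corollary1p4 : (p : ℕ) → Prime p → 7 ≤ p →
    ModEq p 6 (ℕ→ℚ ((2 Data.Nat.* p ∸ 1) C (p ∸ 1)))
      (1ℚ - ℕ→ℚ (2 Data.Nat.* p) * harmonic 1 (p ∸ 1)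
          - ℕ→ℚ (2 Data.Nat.* p ^ 2) * harmonic 2 (p ∸ 1))
    × ModEq p 6 (1ℚ - ℕ→ℚ (2 Data.Nat.* p) * harmonic 1 (p ∸ 1)
          - ℕ→ℚ (2 Data.Nat.* p ^ 2) * harmonic 2 (p ∸ 1))
      (1ℚ + ℕ→ℚ (2 Data.Nat.* p) * harmonic 1 (p ∸ 1)
          + ((+ (2 Data.Nat.* p ^ 3)) / 3) * harmonic 3 (p ∸ 1))
corollary1p4 zero    _       ()
corollary1p4 (suc n) p-prime 7≤p =
    modEq binomial≡ T₁≡ integral-binomial binomial≈T₁
  , modEq T₁≡ T₂≡ (integral-≈ integral-binomial binomial≈T₁) T₁≈T₂
  where
  open pAdic (suc n) p-prime
  open Wolstenholme n p-prime 7≤p
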